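{- If $G$ is a threshold graph with at least one vertex, then $\chi_{ssc}(G)=1$.
   Context: Graphs are finite, simple and undirected. For a vertex $v$, $N(v)$ is its open neighbourhood, $N[v]=N(v)\cup\{v\}$ and $\deg(v)=|N(v)|$. For a positive integer $q$, a $q$-subset square colouring of a graph $G$ is a function $c:V(G)\to\{c_0,c_1,\dots,c_q\}$ such that (i) for every vertex $v$ and every $i\in\{1,\dots,q\}$, $|c^{ -1}(c_i)\cap N[v]|\le 1$, and (ii) for every vertex $v$, $N[v]$ contains at most $\deg(v)$ vertices of colour $c_0$ (equivalently, $N[v]$ contains at least one vertex whose colour lies in $\{c_1,\dots,c_q\}$). $\chi_{ssc}(G)$ is the minimum $q$ such that $G$ admits a $q$-subset square colouring. A threshold graph is a graph that can be constructed from the empty graph by repeatedly adding either an isolated vertex or a dominating vertex (a vertex adjacent to all vertices present so far). -}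

module Defs where

open import Data.Nat using (ℕ; suc; _≤_; _<ᵇ_)
open import Data.Fin using (Fin; toℕ; _≟_)
open import Data.Bool using (Bool; true; false; _∨_; _∧_; if_then_else_)
open import Data.List using (length; filterᵇ; allFin)
open import Data.Vec using (Vec; lookup)
open import Data.Product using (Σ; _×_; ∃)
open import Relation.Nullary.Decidable using (⌊_⌋)
open import Relation.Binary.PropositionalEquality using (_≡_)
open import Function.Bundles using (_↔_; Inverse)

record Graph (n : ℕ) : Set where
  field
    adj   : Fin n → Fin n → Bool
    sym   : ∀ u v → adj u v ≡ adj v u
    irrefl : ∀ v → adj v v ≡ false
open Graph public

count : {n : ℕ} → (Fin n → Bool) → ℕ
count {n} p = length (filterᵇ p (allFin n))

inClosedNbhd : {n : ℕ} → Graph n → Fin n → Fin n → Bool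
inClosedNbhd G v u = ⌊ u ≟ v ⌋ ∨ adj G v u

deg : {n : ℕ} → Graph n → Fin n → ℕ
deg G v = count (adj G v)

-- A q-subset square colouring: colours Fin (suc q); colour 'zero' is c₀,
-- colour 'suc i' (i : Fin q) is c_{i+1}.
record IsSubsetSquareColouring {n : ℕ} (G : Graph n) (q : ℕ)
                               (c : Fin n → Fin (suc q)) : Set where
  field
    cond-i  : ∀ (v : Fin n) (i : Fin q) →
              count (λ u → inClosedNbhd G v u ∧ ⌊ c u ≟ Fin.suc i ⌋) ≤ 1
    cond-ii : ∀ (v : Fin n) →
              count (λ u → inClosedNbhd G v u ∧ ⌊ c u ≟ Fin.zero ⌋) ≤ deg G v

HasSSC : {n : ℕ} → Graph n → ℕ → Set
HasSSC {n} G q = Σ (Fin n → Fin (suc q)) (IsSubsetSquareColouring G q)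

ChiSSC≡ : {n : ℕ} → Graph n → ℕ → Set
ChiSSC≡ G k = (1 ≤ k) × HasSSC G k × (∀ q → 1 ≤ q → HasSSC G q → k ≤ q)

-- Threshold graph built from a construction sequence s : vertex i is added at
-- step i, as a dominating vertex if s[i] = true and as an isolated vertex
-- otherwise.
thresholdAdj : {n : ℕ} → Vec Bool n → Fin n → Fin n → Bool
thresholdAdj s i j =
  if toℕ i <ᵇ toℕ j then lookup s j
  else (if toℕ j <ᵇ toℕ i then lookup s i else false)

_≅_ : {n m : ℕ} → Graph n → Graph m → Set
_≅_ {n} {m} G H = Σ (Fin n ↔ Fin m) λ f →
  ∀ u v → adj G u v ≡ adj H (Inverse.to f u) (Inverse.to f v)

IsThreshold : {n : ℕ} → Graph n → Set
IsThreshold {n} G = Σ (Vec Bool n) λ s →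
  Σ (∀ u v → thresholdAdj s u v ≡ thresholdAdj s v u) λ sy →
  Σ (∀ v → thresholdAdj s v v ≡ false) λ ir →
  G ≅ record { adj = thresholdAdj s ; sym = sy ; irrefl = ir }

{-# OPTIONS --safe #-}
-- The vertices after which no dominating vertex is added (all vertices, if there is no dominating
-- vertex; otherwise the last dominating vertex k and the isolated vertices added after it) form a
-- perfect code: every closed neighbourhood contains exactly one of them.  Two of them are never
-- adjacent, since the later one was added as an isolated vertex, and a vertex added before k is
-- adjacent to k and to no other member of the code.  Colouring the code c₁ and everything else c₀
-- is a 1-subset square colouring: "at most one" gives (i), and "at least one" gives (ii).
module Submission where

open import Level using (Level)
open import Defs
open import Data.Nat as ℕ using (ℕ; _≤_; zero; suc; _<_; z≤n; s≤s; s≤s⁻¹; _<ᵇ_)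
import Data.Nat.Properties as ℕ
open import Data.Fin as Fin using (Fin; toℕ; _≟_)
open import Data.Fin.Properties using (toℕ-injective; suc-injective; 0≢1+n; all?)
open import Data.Bool using (Bool; true; false; _∨_; _∧_; if_then_else_; T)
open import Data.Bool.Properties using (T-∧; T-∨)
open import Data.List using (length; filterᵇ; tabulate)
open import Data.Vec using (Vec; lookup; _∷_; [])
open import Data.Product using (∃; _×_; _,_; proj₁; proj₂)
open import Data.Sum using (_⊎_; inj₁; inj₂)
open import Data.Empty using (⊥-elim)
open import Function using (_∘_; id)
open import Function.Bundles using (_↔_; Inverse; Injection; Equivalence)
open import Function.Properties.Inverse using (↔⇒↣)
open import Relation.Unary using (Pred; Decidable)
open import Relation.Binary using (tri<; tri≈; tri>)
open import Relation.Nullary using (¬_; yes; no; does; ¬?)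
open import Relation.Nullary.Decidable using (⌊_⌋; T?; _→-dec_; toWitness; fromWitness)
open import Relation.Binary.PropositionalEquality using (_≡_; _≢_; refl; trans; cong; cong₂; subst)
import Relation.Binary.PropositionalEquality as ≡

private
  variable
    ℓ : Level
    n : ℕ

length-filterᵇ-tabulate : ∀ {A : Set} (p : A → Bool) (f : Fin n → A) →
                          length (filterᵇ p (tabulate f)) ≡ count (p ∘ f)
length-filterᵇ-tabulate {n = zero}  p f = refl
length-filterᵇ-tabulate {n = suc n} p f with p (f Fin.zero)
... | true  = cong suc (trans (length-filterᵇ-tabulate p (f ∘ Fin.suc))
                              (≡.sym (length-filterᵇ-tabulate (p ∘ f) Fin.suc)))
... | false = trans (length-filterᵇ-tabulate p (f ∘ Fin.suc))
                    (≡.sym (length-filterᵇ-tabulate (p ∘ f) Fin.suc))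

count-here : (p : Fin (suc n) → Bool) → T (p Fin.zero) → count p ≡ suc (count (p ∘ Fin.suc))
count-here p pz with p Fin.zero
... | true = cong suc (length-filterᵇ-tabulate p Fin.suc)

count-there : (p : Fin (suc n) → Bool) → ¬ T (p Fin.zero) → count p ≡ count (p ∘ Fin.suc)
count-there p ¬pz with p Fin.zero
... | true  = ⊥-elim (¬pz _)
... | false = length-filterᵇ-tabulate p Fin.suc

count-none : (p : Fin n → Bool) → (∀ u → ¬ T (p u)) → count p ≡ 0
count-none {n = zero}  p none = refl
count-none {n = suc n} p none =
  trans (count-there p (none Fin.zero)) (count-none (p ∘ Fin.suc) (none ∘ Fin.suc))

count-≤1 : (p : Fin n → Bool) → (∀ {u w} → T (p u) → T (p w) → u ≡ w) → count p ≤ 1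
count-≤1 {n = zero}  p unique = z≤n
count-≤1 {n = suc n} p unique with T? (p Fin.zero)
... | yes pz rewrite count-here p pz =
  s≤s (ℕ.≤-reflexive (count-none (p ∘ Fin.suc) λ u pu → 0≢1+n (unique pz pu)))
... | no ¬pz rewrite count-there p ¬pz =
  count-≤1 (p ∘ Fin.suc) (λ pu pw → suc-injective (unique pu pw))

count-mono : (p q : Fin n → Bool) → (∀ u → T (p u) → T (q u)) → count p ≤ count q
count-mono {n = zero}  p q p⊆q = z≤n
count-mono {n = suc n} p q p⊆q with T? (p Fin.zero) | T? (q Fin.zero)
... | yes pz | no ¬qz = ⊥-elim (¬qz (p⊆q Fin.zero pz))
... | yes pz | yes qz rewrite count-here p pz | count-here q qz =
  s≤s (count-mono (p ∘ Fin.suc) (q ∘ Fin.suc) (p⊆q ∘ Fin.suc))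
... | no ¬pz | yes qz rewrite count-there p ¬pz | count-here q qz =
  ℕ.m≤n⇒m≤1+n (count-mono (p ∘ Fin.suc) (q ∘ Fin.suc) (p⊆q ∘ Fin.suc))
... | no ¬pz | no ¬qz rewrite count-there p ¬pz | count-there q ¬qz =
  count-mono (p ∘ Fin.suc) (q ∘ Fin.suc) (p⊆q ∘ Fin.suc)

count-mono-< : (p q : Fin n → Bool) → (∀ u → T (p u) → T (q u)) →
               ∀ w → T (q w) → ¬ T (p w) → count p < count q
count-mono-< p q p⊆q Fin.zero qw ¬pw rewrite count-there p ¬pw | count-here q qw =
  s≤s (count-mono (p ∘ Fin.suc) (q ∘ Fin.suc) (p⊆q ∘ Fin.suc))
count-mono-< p q p⊆q (Fin.suc w) qw ¬pw with T? (p Fin.zero) | T? (q Fin.zero)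
... | yes pz | no ¬qz = ⊥-elim (¬qz (p⊆q Fin.zero pz))
... | yes pz | yes qz rewrite count-here p pz | count-here q qz =
  s≤s (count-mono-< (p ∘ Fin.suc) (q ∘ Fin.suc) (p⊆q ∘ Fin.suc) w qw ¬pw)
... | no ¬pz | yes qz rewrite count-there p ¬pz | count-here q qz =
  ℕ.m<n⇒m<1+n (count-mono-< (p ∘ Fin.suc) (q ∘ Fin.suc) (p⊆q ∘ Fin.suc) w qw ¬pw)
... | no ¬pz | no ¬qz rewrite count-there p ¬pz | count-there q ¬qz =
  count-mono-< (p ∘ Fin.suc) (q ∘ Fin.suc) (p⊆q ∘ Fin.suc) w qw ¬pw

count-cong : (p q : Fin n → Bool) → (∀ u → p u ≡ q u) → count p ≡ count q
count-cong p q p≗q = ℕ.≤-antisym (count-mono p q λ u → subst T (p≗q u))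
                                 (count-mono q p λ u → subst T (≡.sym (p≗q u)))

count-insert : (p q : Fin n → Bool) (v : Fin n) → T (p v) → ¬ T (q v) →
               (∀ u → u ≢ v → p u ≡ q u) → count p ≡ suc (count q)
count-insert p q Fin.zero pv ¬qv agree rewrite count-here p pv | count-there q ¬qv =
  cong suc (count-cong (p ∘ Fin.suc) (q ∘ Fin.suc) λ u → agree (Fin.suc u) λ ())
count-insert p q (Fin.suc v) pv ¬qv agree with T? (q Fin.zero)
... | yes qz rewrite count-here p (subst T (≡.sym (agree Fin.zero λ ())) qz) | count-here q qz =
  cong suc (count-insert (p ∘ Fin.suc) (q ∘ Fin.suc) v pv ¬qv
                         λ u u≢v → agree (Fin.suc u) (u≢v ∘ suc-injective))
... | no ¬qz rewrite count-there p (¬qz ∘ subst T (agree Fin.zero λ ())) | count-there q ¬qz =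
  count-insert (p ∘ Fin.suc) (q ∘ Fin.suc) v pv ¬qv
               λ u u≢v → agree (Fin.suc u) (u≢v ∘ suc-injective)

module _ (G : Graph n) where

  closedNbhd-self : ∀ v → T (inClosedNbhd G v v)
  closedNbhd-self v = Equivalence.from T-∨ (inj₁ (fromWitness {a? = v ≟ v} refl))

  closedNbhd-adj : ∀ v u → T (adj G v u) → T (inClosedNbhd G v u)
  closedNbhd-adj v u = Equivalence.from T-∨ ∘ inj₂

  closedNbhd-cases : ∀ {v u} → T (inClosedNbhd G v u) → u ≡ v ⊎ T (adj G v u)
  closedNbhd-cases {v} {u} h with Equivalence.to (T-∨ {⌊ u ≟ v ⌋}) h
  ... | inj₁ u≡v = inj₁ (toWitness u≡v)
  ... | inj₂ vu  = inj₂ vu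

  count-closedNbhd : ∀ v → count (inClosedNbhd G v) ≡ suc (deg G v)
  count-closedNbhd v = count-insert (inClosedNbhd G v) (adj G v) v (closedNbhd-self v)
                                    (subst T (irrefl G v)) agree
    where
    agree : ∀ u → u ≢ v → inClosedNbhd G v u ≡ adj G v u
    agree u u≢v with u ≟ v
    ... | yes u≡v = ⊥-elim (u≢v u≡v)
    ... | no _    = refl

  record IsPerfectCode (S : Pred (Fin n) ℓ) : Set ℓ where
    field
      unique    : ∀ v {u w} → T (inClosedNbhd G v u) → T (inClosedNbhd G v w) → S u → S w → u ≡ w
      dominates : ∀ v → ∃ λ w → T (inClosedNbhd G v w) × S w

  module _ {S : Pred (Fin n) ℓ} (S? : Decidable S) where

    codeColouring : Fin n → Fin 2
    codeColouring u = if does (S? u) then Fin.suc Fin.zero else Fin.zero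

    codeColouring-one : ∀ u → T ⌊ codeColouring u ≟ Fin.suc Fin.zero ⌋ → S u
    codeColouring-one u with S? u
    ... | yes Su = λ _ → Su

    codeColouring-zero : ∀ u → T ⌊ codeColouring u ≟ Fin.zero ⌋ → ¬ S u
    codeColouring-zero u with S? u
    ... | no ¬Su = λ _ → ¬Su

    perfectCode⇒subsetSquareColouring : IsPerfectCode S → IsSubsetSquareColouring G 1 codeColouring
    perfectCode⇒subsetSquareColouring code = record { cond-i = cond-i ; cond-ii = cond-ii }
      where
      open IsPerfectCode code

      cond-i : ∀ v (i : Fin 1) →
               count (λ u → inClosedNbhd G v u ∧ ⌊ codeColouring u ≟ Fin.suc i ⌋) ≤ 1
      cond-i v Fin.zero = count-≤1 _ λ {u} {w} hu hw →
        let vu , cu = Equivalence.to T-∧ hu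
            vw , cw = Equivalence.to T-∧ hw
        in unique v vu vw (codeColouring-one u cu) (codeColouring-one w cw)

      cond-ii : ∀ v → count (λ u → inClosedNbhd G v u ∧ ⌊ codeColouring u ≟ Fin.zero ⌋) ≤ deg G v
      cond-ii v with dominates v
      ... | w , vw , Sw = s≤s⁻¹ (subst (count c₀-in-N[v] <_) (count-closedNbhd v)
        (count-mono-< c₀-in-N[v] (inClosedNbhd G v) (λ _ → proj₁ ∘ Equivalence.to T-∧) w vw
                      λ h → codeColouring-zero w (proj₂ (Equivalence.to T-∧ h)) Sw))
        where
        c₀-in-N[v] : Fin n → Bool
        c₀-in-N[v] u = inClosedNbhd G v u ∧ ⌊ codeColouring u ≟ Fin.zero ⌋

    perfectCode⇒hasSSC₁ : IsPerfectCode S → HasSSC G 1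
    perfectCode⇒hasSSC₁ code = codeColouring , perfectCode⇒subsetSquareColouring code

module _ {m} {G : Graph n} {H : Graph m} (G≅H : G ≅ H) where
  private
    f : Fin n ↔ Fin m
    f = proj₁ G≅H

  open Inverse f using (to; from; strictlyInverseˡ)

  closedNbhd-≅ : ∀ v u → inClosedNbhd G v u ≡ inClosedNbhd H (to v) (to u)
  closedNbhd-≅ v u = cong₂ _∨_ same-vertex (proj₂ G≅H v u)
    where
    same-vertex : ⌊ u ≟ v ⌋ ≡ ⌊ to u ≟ to v ⌋
    same-vertex with u ≟ v | to u ≟ to v
    ... | yes _   | yes _     = refl
    ... | no _    | no _      = refl
    ... | yes u≡v | no tu≢tv  = ⊥-elim (tu≢tv (cong to u≡v))
    ... | no u≢v  | yes tu≡tv = ⊥-elim (u≢v (Injection.injective (↔⇒↣ f) tu≡tv))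

  closedNbhd-from : ∀ v w → inClosedNbhd G v (from w) ≡ inClosedNbhd H (to v) w
  closedNbhd-from v w =
    trans (closedNbhd-≅ v (from w)) (cong (inClosedNbhd H (to v)) (strictlyInverseˡ w))

  isPerfectCode-≅ : {S : Pred (Fin m) ℓ} → IsPerfectCode H S → IsPerfectCode G (S ∘ to)
  isPerfectCode-≅ {S = S} code = record { unique = unique′ ; dominates = dominates′ }
    where
    open IsPerfectCode code
    unique′ : ∀ v {u w} → T (inClosedNbhd G v u) → T (inClosedNbhd G v w) →
              S (to u) → S (to w) → u ≡ w
    unique′ v vu vw Su Sw = Injection.injective (↔⇒↣ f)
      (unique (to v) (subst T (closedNbhd-≅ v _) vu) (subst T (closedNbhd-≅ v _) vw) Su Sw)
    dominates′ : ∀ v → ∃ λ w → T (inClosedNbhd G v w) × S (to w)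
    dominates′ v with dominates (to v)
    ... | w , vw , Sw = from w , subst T (≡.sym (closedNbhd-from v w)) vw
                             , subst S (≡.sym (strictlyInverseˡ w)) Sw

NoDominatingAfter : Vec Bool n → Fin n → Set
NoDominatingAfter s j = ∀ i → toℕ j < toℕ i → ¬ T (lookup s i)

noDominatingAfter? : (s : Vec Bool n) → Decidable (NoDominatingAfter s)
noDominatingAfter? s j = all? λ i → (toℕ j ℕ.<? toℕ i) →-dec ¬? (T? (lookup s i))

lastDominating : (s : Vec Bool n) →
                 (∀ i → ¬ T (lookup s i)) ⊎ ∃ λ k → T (lookup s k) × NoDominatingAfter s k
lastDominating [] = inj₁ λ ()
lastDominating (b ∷ s) with lastDominating s
... | inj₂ (k , sk , after) =
  inj₂ (Fin.suc k , sk , λ { Fin.zero () ; (Fin.suc i) (s≤s k<i) → after i k<i })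
lastDominating (true ∷ s)  | inj₁ none = inj₂ (Fin.zero , _ , λ { Fin.zero () ; (Fin.suc i) _ → none i })
lastDominating (false ∷ s) | inj₁ none = inj₁ λ { Fin.zero () ; (Fin.suc i) → none i }

module _ (s : Vec Bool n) where

  thresholdAdj-cases : ∀ {v u} → T (thresholdAdj s v u) →
                       (toℕ v < toℕ u × T (lookup s u)) ⊎ (toℕ u < toℕ v × T (lookup s v))
  thresholdAdj-cases {v} {u} with toℕ v <ᵇ toℕ u | ℕ.<ᵇ⇒< (toℕ v) (toℕ u)
  ... | true  | v<u = λ su → inj₁ (v<u _ , su)
  ... | false | _ with toℕ u <ᵇ toℕ v | ℕ.<ᵇ⇒< (toℕ u) (toℕ v)
  ...   | true  | u<v = λ sv → inj₂ (u<v _ , sv)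
  ...   | false | _   = λ ()

  thresholdAdj-later : ∀ {v u} → toℕ v < toℕ u → T (lookup s u) → T (thresholdAdj s v u)
  thresholdAdj-later {v} {u} v<u with toℕ v <ᵇ toℕ u | ℕ.<⇒<ᵇ v<u
  ... | true | _ = id

  adj-noDominatingAfter : ∀ {v u} → NoDominatingAfter s u → T (thresholdAdj s v u) →
                          toℕ v < toℕ u × T (lookup s u)
  adj-noDominatingAfter after vu with thresholdAdj-cases vu
  ... | inj₁ later       = later
  ... | inj₂ (u<v , sv) = ⊥-elim (after _ u<v sv)

  dominating-noDominatingAfter-unique : ∀ {u w} → NoDominatingAfter s u → NoDominatingAfter s w →
                                        T (lookup s u) → T (lookup s w) → u ≡ w
  dominating-noDominatingAfter-unique {u} {w} after-u after-w su sw with ℕ.<-cmp (toℕ u) (toℕ w)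
  ... | tri< u<w _ _ = ⊥-elim (after-u w u<w sw)
  ... | tri≈ _ u≡w _ = toℕ-injective u≡w
  ... | tri> _ _ w<u = ⊥-elim (after-w u w<u su)

  module _ (sy : ∀ u v → thresholdAdj s u v ≡ thresholdAdj s v u)
           (ir : ∀ v → thresholdAdj s v v ≡ false) where

    thresholdGraph : Graph n
    thresholdGraph = record { adj = thresholdAdj s ; sym = sy ; irrefl = ir }

    noDominatingAfter-isPerfectCode : IsPerfectCode thresholdGraph (NoDominatingAfter s)
    noDominatingAfter-isPerfectCode = record { unique = unique ; dominates = dominates }
      where
      unique : ∀ v {u w} → T (inClosedNbhd thresholdGraph v u) → T (inClosedNbhd thresholdGraph v w) →
               NoDominatingAfter s u → NoDominatingAfter s w → u ≡ w
      unique v vu vw after-u after-w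
        with closedNbhd-cases thresholdGraph vu | closedNbhd-cases thresholdGraph vw
      ... | inj₁ u≡v | inj₁ w≡v = trans u≡v (≡.sym w≡v)
      ... | inj₁ refl | inj₂ vw′ =
        let v<w , sw = adj-noDominatingAfter after-w vw′ in ⊥-elim (after-u _ v<w sw)
      ... | inj₂ vu′ | inj₁ refl =
        let v<u , su = adj-noDominatingAfter after-u vu′ in ⊥-elim (after-w _ v<u su)
      ... | inj₂ vu′ | inj₂ vw′ =
        dominating-noDominatingAfter-unique after-u after-w
          (proj₂ (adj-noDominatingAfter after-u vu′)) (proj₂ (adj-noDominatingAfter after-w vw′))

      dominates : ∀ v → ∃ λ w → T (inClosedNbhd thresholdGraph v w) × NoDominatingAfter s w
      dominates v with lastDominating s
      ... | inj₁ none = v , closedNbhd-self thresholdGraph v , λ i _ → none i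
      ... | inj₂ (k , sk , after-k) with toℕ v ℕ.<? toℕ k
      ...   | yes v<k = k , closedNbhd-adj thresholdGraph v k (thresholdAdj-later v<k sk) , after-k
      ...   | no  v≮k = v , closedNbhd-self thresholdGraph v ,
                        λ i v<i → after-k i (ℕ.≤-<-trans (ℕ.≮⇒≥ v≮k) v<i)

threshold⇒hasSSC₁ : (G : Graph n) → IsThreshold G → HasSSC G 1
threshold⇒hasSSC₁ G (s , sy , ir , G≅H) =
  perfectCode⇒hasSSC₁ G (noDominatingAfter? s ∘ Inverse.to (proj₁ G≅H))
    (isPerfectCode-≅ G≅H (noDominatingAfter-isPerfectCode s sy ir))

mainTheorem19 : ∀ (n : ℕ) (G : Graph n) → 1 ≤ n → IsThreshold G → ChiSSC≡ G 1
mainTheorem19 n G _ threshold = ℕ.≤-refl , threshold⇒hasSSC₁ G threshold , λ q 1≤q _ → 1≤q
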